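{- Let $F\in C(m,n)$ be a good rectangular preorder with exactly two equivalence classes $C_1<C_2$, where $C_1=\{m_j: j\in J\}$ for a set $J$ of consecutive integers in $[1,m-1]$. Set $b=|J|+1$. Then for every vertex $v$ with $v\le F$ we have $\sum_{j\in J}x_j=\binom{b}{2}$, and for every vertex $v$ incomparable with $F$ we have $\sum_{j\in J}x_j>\binom{b}{2}$ (coordinates computed at $v$).
   Context: Fix positive integers $m,n$. $\mathsf{Coll}(m,n)$ is the set of formal symbols $m_1,\dots,m_{m-1}$ ($m_j$ = collision of vertical lines $M_j,M_{j+1}$) and $l_1,\dots,l_{n-1}$ ($l_i$ = collision of horizontal lines $L_i,L_{i+1}$). A preorder is a reflexive transitive relation $\le$; $x\equiv y$ means $x\le y$ and $y\le x$, $x<y$ means $x\le y$ but not $y\le x$, and $x,y$ are comparable if $x\le y$ or $y\le x$. Pairs $\{m_j,l_i\}$ are orthogonal; $\{m_j,m_{j'}\}$ and $\{l_i,l_{i'}\}$ are parallel. Given a preorder, an orthogonal link between parallel $m_i,m_j$ is an $l_s$ with $m_i\le l_s\le m_j$ or $m_j\le l_s\le m_i$; a gap between $m_i,m_j$ is an $m_s$ with $s$ between $i$ and $j$ inclusive and $m_i<m_s$, $m_j<m_s$; symmetrically for $l$'s. A preorder is good rectangular if (1) orthogonal collisions are always comparable and (2) parallel collisions are comparable iff there is an orthogonal link between them or no gap between them. $C(m,n)$ is the set of good rectangular preorders ordered by $P\le Q$ iff $x\le_P y$ implies $x\le_Q y$; a vertex is one in which $x\equiv y$ implies $x=y$. Coordinates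 of a vertex $v$ (comparisons in $v$): $x_j=W_1W_2T$ ($1\le j\le m-1$) with $W_1=j-p+1$ where $p$ is smallest such that $m_k<m_j$ for all $p\le k<j$; $W_2=q-j$ where $q\le m$ is largest such that $m_k<m_j$ for all $j<k<q$; $T=1+\#\{(a,b):1\le a<b\le n,\ l_k<m_j\ \forall\, a\le k<b\}$. -}

module Defs where

open import Data.Nat using (ℕ; zero; suc; _+_; _*_; _∸_; _≤_; _<_)
open import Data.Nat.Combinatorics using (_C_)
open import Data.Bool using (Bool; true; false; T; _∧_; not; if_then_else_)
open import Data.List using (List; map; upTo; concatMap; length; filterᵇ)
open import Data.Nat.ListAction using (sum)
open import Data.Bool.ListAction using (and)
open import Data.Product using (_×_; _,_; ∃; ∃-syntax)
open import Data.Sum using (_⊎_)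
open import Relation.Nullary using (¬_)
open import Relation.Binary.PropositionalEquality using (_≡_)

-- Formal collision symbols: M j stands for m_j, L i for l_i (1-based indices).
data Sym : Set where
  M L : ℕ → Sym

Valid : ℕ → ℕ → Sym → Set
Valid m n (M j) = 1 ≤ j × j ≤ m ∸ 1
Valid m n (L i) = 1 ≤ i × i ≤ n ∸ 1

-- A (decidable) relation on collisions; only its values on valid symbols matter.
PRel : Set
PRel = Sym → Sym → Bool

_⊑[_]_ : Sym → PRel → Sym → Set
x ⊑[ P ] y = T (P x y)

_≣[_]_ : Sym → PRel → Sym → Set
x ≣[ P ] y = x ⊑[ P ] y × y ⊑[ P ] x

_⊏[_]_ : Sym → PRel → Sym → Set
x ⊏[ P ] y = x ⊑[ P ] y × ¬ (y ⊑[ P ] x)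

Comparable : PRel → Sym → Sym → Set
Comparable P x y = x ⊑[ P ] y ⊎ y ⊑[ P ] x

IsPreorderOn : ℕ → ℕ → PRel → Set
IsPreorderOn m n P =
  (∀ x → Valid m n x → x ⊑[ P ] x) ×
  (∀ x y z → Valid m n x → Valid m n y → Valid m n z →
     x ⊑[ P ] y → y ⊑[ P ] z → x ⊑[ P ] z)

OrthLinkM : ℕ → ℕ → PRel → ℕ → ℕ → Set
OrthLinkM m n P i j = ∃[ s ] (Valid m n (L s) ×
  ((M i ⊑[ P ] L s × L s ⊑[ P ] M j) ⊎ (M j ⊑[ P ] L s × L s ⊑[ P ] M i)))

OrthLinkL : ℕ → ℕ → PRel → ℕ → ℕ → Set
OrthLinkL m n P i j = ∃[ s ] (Valid m n (M s) ×
  ((L i ⊑[ P ] M s × M s ⊑[ P ] L j) ⊎ (L j ⊑[ P ] M s × M s ⊑[ P ] L i)))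

Between : ℕ → ℕ → ℕ → Set
Between i j s = (i ≤ s × s ≤ j) ⊎ (j ≤ s × s ≤ i)

GapM : ℕ → ℕ → PRel → ℕ → ℕ → Set
GapM m n P i j = ∃[ s ] (Valid m n (M s) × Between i j s ×
  M i ⊏[ P ] M s × M j ⊏[ P ] M s)

GapL : ℕ → ℕ → PRel → ℕ → ℕ → Set
GapL m n P i j = ∃[ s ] (Valid m n (L s) × Between i j s ×
  L i ⊏[ P ] L s × L j ⊏[ P ] L s)

_⇔_ : Set → Set → Set
A ⇔ B = (A → B) × (B → A)

GoodRect : ℕ → ℕ → PRel → Set
GoodRect m n P =
  IsPreorderOn m n P ×
  (∀ j i → Valid m n (M j) → Valid m n (L i) → Comparable P (M j) (L i)) ×
  (∀ i j → Valid m n (M i) → Valid m n (M j) →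
     Comparable P (M i) (M j) ⇔ (OrthLinkM m n P i j ⊎ ¬ GapM m n P i j)) ×
  (∀ i j → Valid m n (L i) → Valid m n (L j) →
     Comparable P (L i) (L j) ⇔ (OrthLinkL m n P i j ⊎ ¬ GapL m n P i j))

_≤C[_,_]_ : PRel → ℕ → ℕ → PRel → Set
P ≤C[ m , n ] Q = ∀ x y → Valid m n x → Valid m n y → x ⊑[ P ] y → x ⊑[ Q ] y

IsVertex : ℕ → ℕ → PRel → Set
IsVertex m n P = ∀ x y → Valid m n x → Valid m n y → x ≣[ P ] y → x ≡ y

allB : {A : Set} → (A → Bool) → List A → Bool
allB p xs = and (map p xs)

ltB : PRel → Sym → Sym → Bool
ltB P x y = P x y ∧ not (P y x)

range : ℕ → ℕ → List ℕ
range lo hi = map (lo +_) (upTo (hi ∸ lo))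

-- first s in s0, s0+1, ..., s0+fuel-1 satisfying f; default s0+fuel
findFirst : (ℕ → Bool) → ℕ → ℕ → ℕ
findFirst f s zero = s
findFirst f s (suc k) = if f s then s else findFirst f (suc s) k

-- first s in s0, s0-1, ..., s0-fuel+1 satisfying f; default s0-fuel
findLast : (ℕ → Bool) → ℕ → ℕ → ℕ
findLast f s zero = s
findLast f s (suc k) = if f s then s else findLast f (s ∸ 1) k

-- p = smallest p ∈ [1, j] with m_k < m_j for all p ≤ k < j
pIdx : PRel → ℕ → ℕ
pIdx v j = findFirst (λ p → allB (λ k → ltB v (M k) (M j)) (range p j)) 1 (j ∸ 1)

-- q = largest q ≤ m (q ≥ j+1) with m_k < m_j for all j < k < q
qIdx : ℕ → PRel → ℕ → ℕ
qIdx m v j = findLast (λ q → allB (λ k → ltB v (M k) (M j)) (range (suc j) q)) m (m ∸ suc j)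

W1 : PRel → ℕ → ℕ
W1 v j = j ∸ pIdx v j + 1

W2 : ℕ → PRel → ℕ → ℕ
W2 m v j = qIdx m v j ∸ j

pairs : ℕ → List (ℕ × ℕ)
pairs n = concatMap (λ a → map (λ b → (a , b)) (range (suc a) (suc n))) (range 1 (suc n))

Tc : ℕ → PRel → ℕ → ℕ
Tc n v j = 1 + length (filterᵇ (λ { (a , b) → allB (λ k → ltB v (L k) (M j)) (range a b) }) (pairs n))

coord : ℕ → ℕ → PRel → ℕ → ℕ
coord m n v j = W1 v j * W2 m v j * Tc n v j

sumFromTo : ℕ → ℕ → (ℕ → ℕ) → ℕ
sumFromTo a c f = sum (map f (range a (suc c)))

InJ : ℕ → ℕ → Sym → Set
InJ a c x = ∃[ j ] (x ≡ M j × a ≤ j × j ≤ c)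

TwoClasses : ℕ → ℕ → PRel → ℕ → ℕ → Set
TwoClasses m n F a c =
  (∀ x y → Valid m n x → Valid m n y → InJ a c x → InJ a c y → x ⊑[ F ] y) ×
  (∀ x y → Valid m n x → Valid m n y → ¬ InJ a c x → ¬ InJ a c y → x ⊑[ F ] y) ×
  (∀ x y → Valid m n x → Valid m n y → InJ a c x → ¬ InJ a c y → x ⊏[ F ] y) ×
  (∃[ y ] (Valid m n y × ¬ InJ a c y))

-- Clip the window of each m_j to an interval [s, e): in a vertex the clipped products W₁ W₂ over
-- [s, e) add up to C(e − s + 1, 2). Indeed the interval has a strict maximum m_j (neighbouring
-- collisions have no gap between them, so they are comparable, and a vertex has no ties), and
-- splitting at it gives C(L₁ + 1, 2) + (L₁ + 1)(L₂ + 1) + C(L₂ + 1, 2) by induction. Every coordinate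
-- x_j dominates its clipped value on J, strictly unless the window of m_j stays inside J and no l_i
-- lies below m_j. All j ∈ J are confined in this sense exactly when nothing outside J lies below J
-- in v, i.e. when v ≤ F; otherwise one term, hence the sum, is strictly larger.
module Submission where

open import Defs
open import Data.Nat using (ℕ; suc; _+_; _∸_; _≤_; _<_)
open import Data.Nat.Combinatorics using (_C_)
open import Data.Product using (_×_)
open import Relation.Nullary using (¬_)
open import Relation.Binary.PropositionalEquality using (_≡_)

open import Data.Bool using (Bool; true; false; T; T?)
open import Data.Bool.Properties using (T-∧)
open import Data.Empty using (⊥-elim)
open import Data.List using ([]; _∷_; map; applyUpTo; length; filterᵇ)
open import Data.List.Membership.Propositional using (_∈_; find)
open import Data.List.Membership.Propositional.Properties
  using (∈-map⁺; ∈-map⁻; ∈-upTo⁺; ∈-upTo⁻; ∈-concat⁺′; ∈-concat⁻′; ∈-filter⁺)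
open import Data.List.Properties using (map-upTo; filter-none)
open import Data.List.Relation.Unary.All as All using (All; all?)
open import Data.List.Relation.Unary.All.Properties using (¬All⇒Any¬)
open import Data.List.Relation.Unary.Any using (here; there)
open import Data.Nat using (zero; _*_; _⊔_; _⊓_; z≤n; s≤s; s≤s⁻¹; z<s; _≟_; _≤?_; _<?_; >-nonZero)
open import Data.Nat.Combinatorics using (nCk+nC[k+1]≡[n+1]C[k+1]; nC1≡n)
open import Data.Nat.Induction using (<-rec)
open import Data.Nat.Solver using (module +-*-Solver)
open import Data.Nat.ListAction using (sum)
open import Data.Nat.Properties
open import Data.Product using (_,_; proj₁; proj₂; ∃; uncurry)
open import Data.Sum using (_⊎_; inj₁; inj₂)
open import Data.Unit using (tt)
open import Function using (_∘_; Equivalence)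
open import Relation.Nullary using (Dec; yes; no; contradiction)
open import Relation.Nullary.Decidable using (_×-dec_)
open import Relation.Binary.PropositionalEquality
  using (_≢_; refl; sym; trans; cong; cong₂; subst; module ≡-Reasoning)

≤∸1⇒< : ∀ {i k} → 1 ≤ i → i ≤ k ∸ 1 → i < k
≤∸1⇒< {suc i} {suc k} _ i≤k = s≤s i≤k

<⇒≤∸1 : ∀ {i k} → i < k → i ≤ k ∸ 1
<⇒≤∸1 {i} {suc k} (s≤s i≤k) = i≤k

*-mono-<-≤ : ∀ {a a′ b b′} → a < a′ → 0 < b → b ≤ b′ → a * b < a′ * b′
*-mono-<-≤ {a′ = a′} {b = suc b} a<a′ _ b≤b′ =
  <-≤-trans (*-monoˡ-< (suc b) a<a′) (*-mono-≤ (≤-refl {a′}) b≤b′)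

*-mono-≤-< : ∀ {a a′ b b′} → a ≤ a′ → 0 < a → b < b′ → a * b < a′ * b′
*-mono-≤-< {a = suc a} a≤a′ _ b<b′ = <-≤-trans (*-monoʳ-< (suc a) b<b′) (*-mono-≤ a≤a′ ≤-refl)

triangle : ℕ → ℕ
triangle zero    = 0
triangle (suc k) = suc k + triangle k

suc[k]C2≡triangle : ∀ k → suc k C 2 ≡ triangle k
suc[k]C2≡triangle zero    = refl
suc[k]C2≡triangle (suc k) = begin
  suc (suc k) C 2                 ≡⟨ sym (nCk+nC[k+1]≡[n+1]C[k+1] (suc k) 1) ⟩
  suc k C 1 + suc k C 2           ≡⟨ cong₂ _+_ (nC1≡n (suc k)) (suc[k]C2≡triangle k) ⟩
  suc k + triangle k              ∎
  where open ≡-Reasoning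

triangle-+ : ∀ k l → triangle (k + suc l) ≡ triangle k + (suc k * suc l + triangle l)
triangle-+ zero    l = sym (cong (_+ triangle l) (+-identityʳ (suc l)))
triangle-+ (suc k) l = begin
  suc (k + suc l) + triangle (k + suc l)
    ≡⟨ cong (suc (k + suc l) +_) (triangle-+ k l) ⟩
  suc (k + suc l) + (triangle k + (suc k * suc l + triangle l))
    ≡⟨ solve 4 (λ k l tk tl →
          (con 1 :+ (k :+ (con 1 :+ l))) :+ (tk :+ ((con 1 :+ k) :* (con 1 :+ l) :+ tl)) :=
          (con 1 :+ k) :+ tk :+ ((con 2 :+ k) :* (con 1 :+ l) :+ tl))
        refl k l (triangle k) (triangle l) ⟩
  suc k + triangle k + (suc (suc k) * suc l + triangle l) ∎
  where
  open ≡-Reasoning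
  open +-*-Solver using (solve; _:=_; con; _:+_; _:*_)

sumFrom : (ℕ → ℕ) → ℕ → ℕ → ℕ
sumFrom f lo zero    = 0
sumFrom f lo (suc k) = f lo + sumFrom f (suc lo) k

private
  lo<lo+suc : ∀ lo k → lo < lo + suc k
  lo<lo+suc lo k = m<m+n lo z<s

  <-shift : ∀ {i} lo k → i < suc lo + k → i < lo + suc k
  <-shift {i} lo k = subst (i <_) (sym (+-suc lo k))

sum-applyUpTo : ∀ f h lo k → (∀ i → h i ≡ lo + i) →
                sum (map f (applyUpTo h k)) ≡ sumFrom f lo k
sum-applyUpTo f h lo zero    h≗ = refl
sum-applyUpTo f h lo (suc k) h≗ = cong₂ _+_ (cong f (trans (h≗ 0) (+-identityʳ lo)))
  (sum-applyUpTo f (h ∘ suc) (suc lo) k (λ i → trans (h≗ (suc i)) (+-suc lo i)))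

sum-range : ∀ f lo hi → sum (map f (range lo hi)) ≡ sumFrom f lo (hi ∸ lo)
sum-range f lo hi = trans (cong (sum ∘ map f) (map-upTo (lo +_) (hi ∸ lo)))
                          (sum-applyUpTo f (lo +_) lo (hi ∸ lo) (λ _ → refl))

sumFrom-++ : ∀ f lo k l → sumFrom f lo (k + l) ≡ sumFrom f lo k + sumFrom f (lo + k) l
sumFrom-++ f lo zero    l = cong (λ lo′ → sumFrom f lo′ l) (sym (+-identityʳ lo))
sumFrom-++ f lo (suc k) l = begin
  f lo + sumFrom f (suc lo) (k + l)
    ≡⟨ cong (f lo +_) (sumFrom-++ f (suc lo) k l) ⟩
  f lo + (sumFrom f (suc lo) k + sumFrom f (suc lo + k) l)
    ≡⟨ sym (+-assoc (f lo) _ _) ⟩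
  f lo + sumFrom f (suc lo) k + sumFrom f (suc lo + k) l
    ≡⟨ cong (λ lo′ → f lo + sumFrom f (suc lo) k + sumFrom f lo′ l) (sym (+-suc lo k)) ⟩
  f lo + sumFrom f (suc lo) k + sumFrom f (lo + suc k) l ∎
  where open ≡-Reasoning

sumFrom-mono-≤ : ∀ {f g} lo k → (∀ {i} → lo ≤ i → i < lo + k → f i ≤ g i) →
                 sumFrom f lo k ≤ sumFrom g lo k
sumFrom-mono-≤ lo zero    f≤g = z≤n
sumFrom-mono-≤ lo (suc k) f≤g = +-mono-≤ (f≤g ≤-refl (lo<lo+suc lo k))
  (sumFrom-mono-≤ (suc lo) k (λ lo<i i< → f≤g (<⇒≤ lo<i) (<-shift lo k i<)))

sumFrom-cong : ∀ {f g} lo k → (∀ {i} → lo ≤ i → i < lo + k → f i ≡ g i) →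
               sumFrom f lo k ≡ sumFrom g lo k
sumFrom-cong lo k f≗g = ≤-antisym (sumFrom-mono-≤ lo k (λ p q → ≤-reflexive (f≗g p q)))
                                  (sumFrom-mono-≤ lo k (λ p q → ≤-reflexive (sym (f≗g p q))))

sumFrom-mono-< : ∀ {f g} lo k → (∀ {i} → lo ≤ i → i < lo + k → f i ≤ g i) →
                 ∀ {j} → lo ≤ j → j < lo + k → f j < g j → sumFrom f lo k < sumFrom g lo k
sumFrom-mono-< lo zero f≤g lo≤j j<lo+0 _ =
  contradiction (≤-<-trans lo≤j (subst (_ <_) (+-identityʳ lo) j<lo+0)) (<-irrefl refl)
sumFrom-mono-< lo (suc k) f≤g {j} lo≤j j< fj<gj with lo ≟ j
... | yes refl = +-mono-<-≤ fj<gj (sumFrom-mono-≤ (suc lo) k (λ lo<i i< → f≤g (<⇒≤ lo<i) (<-shift lo k i<)))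
... | no lo≢j = +-mono-≤-< (f≤g ≤-refl (lo<lo+suc lo k))
  (sumFrom-mono-< (suc lo) k (λ lo<i i< → f≤g (<⇒≤ lo<i) (<-shift lo k i<))
    (≤∧≢⇒< lo≤j lo≢j) (subst (j <_) (+-suc lo k) j<) fj<gj)

∈-range⁺ : ∀ {lo hi i} → lo ≤ i → i < hi → i ∈ range lo hi
∈-range⁺ {lo} {hi} lo≤i i<hi =
  subst (_∈ range lo hi) (m+[n∸m]≡n lo≤i) (∈-map⁺ (lo +_) (∈-upTo⁺ (∸-monoˡ-< i<hi lo≤i)))

∈-range⁻ : ∀ lo hi {i} → i ∈ range lo hi → lo ≤ i × i < hi
∈-range⁻ lo hi i∈ with ∈-map⁻ (lo +_) i∈
... | k , k∈ , refl = m≤m+n lo k , subst (lo + k <_) (m+[n∸m]≡n lo≤hi) (+-monoʳ-< lo k<)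
  where
  k< : k < hi ∸ lo
  k< = ∈-upTo⁻ k∈
  lo≤hi : lo ≤ hi
  lo≤hi = <⇒≤ (m∸n≢0⇒n<m (λ hi∸lo≡0 → n≮0 (subst (k <_) hi∸lo≡0 k<)))

T-allB⁻ : ∀ {A : Set} (g : A → Bool) {xs x} → T (allB g xs) → x ∈ xs → T (g x)
T-allB⁻ g {y ∷ ys} t (here refl) = proj₁ (Equivalence.to (T-∧ {g y}) t)
T-allB⁻ g {y ∷ ys} t (there x∈)  = T-allB⁻ g (proj₂ (Equivalence.to (T-∧ {g y}) t)) x∈

T-allB⁺ : ∀ {A : Set} (g : A → Bool) xs → (∀ {x} → x ∈ xs → T (g x)) → T (allB g xs)
T-allB⁺ g []       all = tt
T-allB⁺ g (y ∷ ys) all = Equivalence.from (T-∧ {g y}) (all (here refl) , T-allB⁺ g ys (all ∘ there))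

allB-range⁻ : ∀ (g : ℕ → Bool) {lo hi} → T (allB g (range lo hi)) → ∀ {i} → lo ≤ i → i < hi → T (g i)
allB-range⁻ g t lo≤i i<hi = T-allB⁻ g t (∈-range⁺ lo≤i i<hi)

allB-range⁺ : ∀ (g : ℕ → Bool) lo hi → (∀ {i} → lo ≤ i → i < hi → T (g i)) → T (allB g (range lo hi))
allB-range⁺ g lo hi all = T-allB⁺ g (range lo hi) (uncurry all ∘ ∈-range⁻ lo hi)

∈-pairs⁻ : ∀ {n i j} → (i , j) ∈ pairs n → 1 ≤ i × i < j × j ≤ n
∈-pairs⁻ {n} ij∈ with ∈-concat⁻′ (map row (range 1 (suc n))) ij∈
  where row = λ i → map (λ j → (i , j)) (range (suc i) (suc n))
... | xs , ij∈xs , xs∈ with ∈-map⁻ _ xs∈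
... | i , i∈ , refl with ∈-map⁻ _ ij∈xs
... | j , j∈ , refl with ∈-range⁻ 1 (suc n) i∈ | ∈-range⁻ (suc i) (suc n) j∈
... | 1≤i , _ | i<j , j<1+n = 1≤i , i<j , s≤s⁻¹ j<1+n

∈-pairs⁺ : ∀ {n i j} → 1 ≤ i → i < j → j ≤ n → (i , j) ∈ pairs n
∈-pairs⁺ {n} {i} 1≤i i<j j≤n =
  ∈-concat⁺′ (∈-map⁺ (λ j → (i , j)) (∈-range⁺ i<j (s≤s j≤n)))
             (∈-map⁺ (λ i → map (λ j → (i , j)) (range (suc i) (suc n)))
                     (∈-range⁺ 1≤i (s≤s (≤-trans (<⇒≤ i<j) j≤n))))

length-filterᵇ-none : ∀ {A : Set} (p : A → Bool) xs → (∀ {x} → x ∈ xs → ¬ T (p x)) →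
                      length (filterᵇ p xs) ≡ 0
length-filterᵇ-none p xs none = cong length (filter-none (T? ∘ p) (All.tabulate none))

length-filterᵇ-some : ∀ {A : Set} (p : A → Bool) {xs x} → x ∈ xs → T (p x) → 0 < length (filterᵇ p xs)
length-filterᵇ-some p x∈ px = nonempty (∈-filter⁺ (T? ∘ p) x∈ px)
  where
  nonempty : ∀ {A : Set} {x : A} {ys} → x ∈ ys → 0 < length ys
  nonempty (here _)  = z<s
  nonempty (there _) = z<s

module _ (f : ℕ → Bool) where

  findFirst-≥ : ∀ s k → s ≤ findFirst f s k
  findFirst-≥ s zero = ≤-refl
  findFirst-≥ s (suc k) with f s
  ... | true  = ≤-refl
  ... | false = <⇒≤ (findFirst-≥ (suc s) k)

  findFirst-≤ : ∀ s k → findFirst f s k ≤ s + k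
  findFirst-≤ s zero = ≤-reflexive (sym (+-identityʳ s))
  findFirst-≤ s (suc k) with f s
  ... | true  = m≤m+n s (suc k)
  ... | false = subst (findFirst f (suc s) k ≤_) (sym (+-suc s k)) (findFirst-≤ (suc s) k)

  findFirst-found : ∀ s k → T (f (findFirst f s k)) ⊎ findFirst f s k ≡ s + k
  findFirst-found s zero = inj₂ (sym (+-identityʳ s))
  findFirst-found s (suc k) with f s in fs
  ... | true  = inj₁ (subst T (sym fs) tt)
  ... | false with findFirst-found (suc s) k
  ...   | inj₁ found   = inj₁ found
  ...   | inj₂ default = inj₂ (trans default (sym (+-suc s k)))

  findFirst-least : ∀ s k {i} → s ≤ i → i < s + k → T (f i) → findFirst f s k ≤ i
  findFirst-least s zero s≤i i<s+0 _ = contradiction (subst (_ <_) (+-identityʳ s) i<s+0) (≤⇒≯ s≤i)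
  findFirst-least s (suc k) {i} s≤i i< fi with f s in fs
  ... | true  = s≤i
  ... | false with s ≟ i
  ...   | yes refl = contradiction (subst T fs fi) λ ()
  ...   | no s≢i   = findFirst-least (suc s) k (≤∧≢⇒< s≤i s≢i) (subst (i <_) (+-suc s k) i<) fi

  findLast-≤ : ∀ s k → findLast f s k ≤ s
  findLast-≤ s zero = ≤-refl
  findLast-≤ s (suc k) with f s
  ... | true  = ≤-refl
  ... | false = ≤-trans (findLast-≤ (s ∸ 1) k) (m∸n≤m s 1)

  findLast-≥ : ∀ s k → s ∸ k ≤ findLast f s k
  findLast-≥ s zero = ≤-refl
  findLast-≥ s (suc k) with f s
  ... | true  = m∸n≤m s (suc k)
  ... | false = subst (_≤ findLast f (s ∸ 1) k) (∸-+-assoc s 1 k) (findLast-≥ (s ∸ 1) k)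

  findLast-found : ∀ s k → T (f (findLast f s k)) ⊎ findLast f s k ≡ s ∸ k
  findLast-found s zero = inj₂ refl
  findLast-found s (suc k) with f s in fs
  ... | true  = inj₁ (subst T (sym fs) tt)
  ... | false with findLast-found (s ∸ 1) k
  ...   | inj₁ found   = inj₁ found
  ...   | inj₂ default = inj₂ (trans default (∸-+-assoc s 1 k))

  findLast-greatest : ∀ s k {i} → i ≤ s → s ∸ k < i → T (f i) → i ≤ findLast f s k
  findLast-greatest s zero i≤s s<i _ = contradiction i≤s (<⇒≱ s<i)
  findLast-greatest s (suc k) {i} i≤s s∸k< fi with f s in fs
  ... | true  = i≤s
  ... | false with i ≟ s
  ...   | yes refl = contradiction (subst T fs fi) λ ()
  ...   | no i≢s   = findLast-greatest (s ∸ 1) k (<⇒≤∸1 (≤∧≢⇒< i≤s i≢s))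
                       (subst (_< i) (sym (∸-+-assoc s 1 k)) s∸k<) fi

T-ltB⁻ : ∀ (P : PRel) x y → T (ltB P x y) → x ⊏[ P ] y
T-ltB⁻ P x y t with P x y | P y x
... | true  | false = tt , λ ()
... | true  | true  = ⊥-elim t
... | false | _     = ⊥-elim t

T-ltB⁺ : ∀ (P : PRel) x y → x ⊏[ P ] y → T (ltB P x y)
T-ltB⁺ P x y (x⊑y , y⋢x) with P x y | P y x
... | true  | false = tt
... | true  | true  = y⋢x tt
... | false | _     = x⊑y

⊏-asym : ∀ {P : PRel} {x y} → x ⊏[ P ] y → ¬ y ⊏[ P ] x
⊏-asym (_ , y⋢x) (y⊑x , _) = y⋢x y⊑x

⊏-irrefl : ∀ {P : PRel} {x} → ¬ x ⊏[ P ] x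
⊏-irrefl {P} x⊏x = ⊏-asym {P} x⊏x x⊏x

-- The factor W₁ W₂ of x_j as it would be if only the vertical collisions m_s, …, m_{e-1} existed.
truncCoord : ℕ → PRel → ℕ → ℕ → ℕ → ℕ
truncCoord m v s e j = (j ∸ (s ⊔ pIdx v j) + 1) * (e ⊓ qIdx m v j ∸ j)

Confined : ℕ → ℕ → PRel → ℕ → ℕ → ℕ → Set
Confined m n v s e j = s ≤ pIdx v j × qIdx m v j ≤ e × Tc n v j ≡ 1

module Coordinates (m n : ℕ) (v : PRel) where

  validM⁺ : ∀ {j} → 1 ≤ j → j < m → Valid m n (M j)
  validM⁺ 1≤j j<m = 1≤j , <⇒≤∸1 j<m

  validM⁻ : ∀ {j} → Valid m n (M j) → j < m
  validM⁻ (1≤j , j≤m∸1) = ≤∸1⇒< 1≤j j≤m∸1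

  pIdx-bounds : ∀ {j} → 1 ≤ j → 1 ≤ pIdx v j × pIdx v j ≤ j
  pIdx-bounds {j} 1≤j =
    findFirst-≥ _ 1 (j ∸ 1) , subst (pIdx v j ≤_) (m+[n∸m]≡n 1≤j) (findFirst-≤ _ 1 (j ∸ 1))

  pIdx-below : ∀ {j k} → 1 ≤ j → pIdx v j ≤ k → k < j → M k ⊏[ v ] M j
  pIdx-below {j} {k} 1≤j p≤k k<j with findFirst-found _ 1 (j ∸ 1)
  ... | inj₁ found   = T-ltB⁻ v (M k) (M j) (allB-range⁻ _ found p≤k k<j)
  ... | inj₂ default = contradiction (subst (_≤ k) (trans default (m+[n∸m]≡n 1≤j)) p≤k) (<⇒≱ k<j)

  pIdx-least : ∀ {j p} → 1 ≤ p → p ≤ j → (∀ {k} → p ≤ k → k < j → M k ⊏[ v ] M j) → pIdx v j ≤ p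
  pIdx-least {j} {p} 1≤p p≤j below with p ≟ j
  ... | yes refl = proj₂ (pIdx-bounds 1≤p)
  ... | no p≢j   = findFirst-least _ 1 (j ∸ 1) 1≤p
      (subst (p <_) (sym (m+[n∸m]≡n (≤-trans 1≤p p≤j))) (≤∧≢⇒< p≤j p≢j))
      (allB-range⁺ _ p j (λ {k} p≤k k<j → T-ltB⁺ v (M k) (M j) (below p≤k k<j)))

  pIdx-blocked : ∀ {i j} → 1 ≤ i → j < i → M i ⊏[ v ] M j → j < pIdx v i
  pIdx-blocked 1≤i j<i i⊏j = ≰⇒> λ p≤j → ⊏-asym {v} i⊏j (pIdx-below 1≤i p≤j j<i)

  qIdx-bounds : ∀ {j} → j < m → suc j ≤ qIdx m v j × qIdx m v j ≤ m
  qIdx-bounds {j} j<m =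
    subst (_≤ qIdx m v j) (m∸[m∸n]≡n j<m) (findLast-≥ _ m (m ∸ suc j)) , findLast-≤ _ m (m ∸ suc j)

  qIdx-below : ∀ {j k} → j < m → j < k → k < qIdx m v j → M k ⊏[ v ] M j
  qIdx-below {j} {k} j<m j<k k<q with findLast-found _ m (m ∸ suc j)
  ... | inj₁ found   = T-ltB⁻ v (M k) (M j) (allB-range⁻ _ found j<k k<q)
  ... | inj₂ default = contradiction (subst (k <_) (trans default (m∸[m∸n]≡n j<m)) k<q) (≤⇒≯ j<k)

  qIdx-greatest : ∀ {j q} → j < m → suc j ≤ q → q ≤ m →
                  (∀ {k} → j < k → k < q → M k ⊏[ v ] M j) → q ≤ qIdx m v j
  qIdx-greatest {j} {q} j<m j<q q≤m below with q ≟ suc j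
  ... | yes refl = proj₁ (qIdx-bounds j<m)
  ... | no q≢1+j = findLast-greatest _ m (m ∸ suc j) q≤m
      (subst (_< q) (sym (m∸[m∸n]≡n j<m)) (≤∧≢⇒< j<q (q≢1+j ∘ sym)))
      (allB-range⁺ _ (suc j) q (λ {k} j<k k<q → T-ltB⁺ v (M k) (M j) (below j<k k<q)))

  qIdx-blocked : ∀ {i j} → i < m → i < j → M i ⊏[ v ] M j → qIdx m v i ≤ j
  qIdx-blocked i<m i<j i⊏j = ≮⇒≥ λ j<q → ⊏-asym {v} i⊏j (qIdx-below i<m i<j j<q)

  Tc≡1 : ∀ {j} → (∀ {s} → 1 ≤ s → s < n → ¬ L s ⊏[ v ] M j) → Tc n v j ≡ 1
  Tc≡1 {j} none = cong suc (length-filterᵇ-none _ (pairs n) λ { {s , t} st∈ all →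
    let 1≤s , s<t , t≤n = ∈-pairs⁻ st∈ in
    none 1≤s (<-≤-trans s<t t≤n) (T-ltB⁻ v (L s) (M j) (allB-range⁻ _ all ≤-refl s<t)) })

  1<Tc : ∀ {j s} → 1 ≤ s → s < n → L s ⊏[ v ] M j → 1 < Tc n v j
  1<Tc {j} {s} 1≤s s<n s⊏j = s≤s (length-filterᵇ-some _ (∈-pairs⁺ 1≤s ≤-refl s<n)
    (allB-range⁺ _ s (suc s) λ {k} s≤k k≤s →
      T-ltB⁺ v (L k) (M j) (subst (λ k → L k ⊏[ v ] M j) (≤-antisym s≤k (s≤s⁻¹ k≤s)) s⊏j)))

  truncCoord-start : ∀ {s s′ e j} → s ≤ pIdx v j → s′ ≤ pIdx v j →
                     truncCoord m v s e j ≡ truncCoord m v s′ e j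
  truncCoord-start {e = e} {j} s≤p s′≤p =
    cong (λ x → (j ∸ x + 1) * (e ⊓ qIdx m v j ∸ j))
         (trans (m≤n⇒m⊔n≡n s≤p) (sym (m≤n⇒m⊔n≡n s′≤p)))

  truncCoord-end : ∀ {s e e′ j} → qIdx m v j ≤ e → qIdx m v j ≤ e′ →
                   truncCoord m v s e j ≡ truncCoord m v s e′ j
  truncCoord-end {s} {j = j} q≤e q≤e′ =
    cong (λ x → (j ∸ (s ⊔ pIdx v j) + 1) * (x ∸ j))
         (trans (m≥n⇒m⊓n≡n q≤e) (sym (m≥n⇒m⊓n≡n q≤e′)))

  truncCoord-peak : ∀ {s e j} → pIdx v j ≤ s → e ≤ qIdx m v j →
                    truncCoord m v s e j ≡ (j ∸ s + 1) * (e ∸ j)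
  truncCoord-peak {j = j} p≤s e≤q =
    cong₂ (λ x y → (j ∸ x + 1) * (y ∸ j)) (m≥n⇒m⊔n≡m p≤s) (m≤n⇒m⊓n≡m e≤q)

  module _ {s e j : ℕ} where

    private
      W₁-trunc : j ∸ (s ⊔ pIdx v j) + 1 ≤ W1 v j
      W₁-trunc = +-monoˡ-≤ 1 (∸-monoʳ-≤ j (m≤n⊔m s (pIdx v j)))

      W₂-trunc : e ⊓ qIdx m v j ∸ j ≤ W2 m v j
      W₂-trunc = ∸-monoˡ-≤ j (m⊓n≤n e (qIdx m v j))

      0<x+1 : ∀ x → 0 < x + 1
      0<x+1 x = m≤n+m 1 x

      W₁W₂≤coord : W1 v j * W2 m v j ≤ coord m n v j
      W₁W₂≤coord = m≤m*n _ (Tc n v j)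

    truncCoord≤coord : truncCoord m v s e j ≤ coord m n v j
    truncCoord≤coord = ≤-trans (*-mono-≤ W₁-trunc W₂-trunc) W₁W₂≤coord

    truncCoord≡coord : Confined m n v s e j → truncCoord m v s e j ≡ coord m n v j
    truncCoord≡coord (s≤p , q≤e , Tc≡1) = begin
      truncCoord m v s e j
        ≡⟨ cong₂ (λ x y → (j ∸ x + 1) * (y ∸ j)) (m≤n⇒m⊔n≡n s≤p) (m≥n⇒m⊓n≡n q≤e) ⟩
      W1 v j * W2 m v j                 ≡⟨ sym (*-identityʳ _) ⟩
      W1 v j * W2 m v j * 1             ≡⟨ cong (W1 v j * W2 m v j *_) (sym Tc≡1) ⟩
      coord m n v j                     ∎
      where open ≡-Reasoning

    truncCoord<coord : j < m → s ≤ j → j < e → ¬ Confined m n v s e j → truncCoord m v s e j < coord m n v j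
    truncCoord<coord j<m s≤j j<e unconfined
      with s ≤? pIdx v j | qIdx m v j ≤? e | Tc n v j ≟ 1
    ... | yes s≤p | yes q≤e | yes Tc≡1 = contradiction (s≤p , q≤e , Tc≡1) unconfined
    ... | no s≰p | _ | _ = <-≤-trans (*-mono-<-≤ W₁-strict 0<W₂-trunc W₂-trunc) W₁W₂≤coord
      where
      W₁-strict : j ∸ (s ⊔ pIdx v j) + 1 < W1 v j
      W₁-strict = +-monoˡ-< 1 (subst (_< j ∸ pIdx v j) (cong (j ∸_) (sym (m≥n⇒m⊔n≡m (<⇒≤ (≰⇒> s≰p)))))
                                     (∸-monoʳ-< (≰⇒> s≰p) s≤j))
      0<W₂-trunc : 0 < e ⊓ qIdx m v j ∸ j
      0<W₂-trunc = m<n⇒0<n∸m (⊓-glb j<e (proj₁ (qIdx-bounds j<m)))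
    ... | yes _ | no q≰e | _ = <-≤-trans (*-mono-≤-< W₁-trunc (0<x+1 _) W₂-strict) W₁W₂≤coord
      where
      W₂-strict : e ⊓ qIdx m v j ∸ j < W2 m v j
      W₂-strict = subst (λ x → x ∸ j < W2 m v j) (sym (m≤n⇒m⊓n≡m (<⇒≤ (≰⇒> q≰e))))
                        (∸-monoˡ-< (≰⇒> q≰e) (<⇒≤ j<e))
    ... | yes _ | yes _ | no Tc≢1 = ≤-<-trans (*-mono-≤ W₁-trunc W₂-trunc) W₁W₂<coord
      where
      0<W₁W₂ : 0 < W1 v j * W2 m v j
      0<W₁W₂ = *-mono-≤ (0<x+1 (j ∸ pIdx v j)) (m<n⇒0<n∸m (proj₁ (qIdx-bounds j<m)))
      W₁W₂<coord : W1 v j * W2 m v j < coord m n v j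
      W₁W₂<coord = m<m*n _ _ {{>-nonZero 0<W₁W₂}} (≤∧≢⇒< (s≤s z≤n) (Tc≢1 ∘ sym))

module Vertex {m n : ℕ} {v : PRel} (good : GoodRect m n v) (vertex : IsVertex m n v) where

  open Coordinates m n v

  ⊑-trans : ∀ {x y z} → Valid m n x → Valid m n y → Valid m n z → x ⊑[ v ] y → y ⊑[ v ] z → x ⊑[ v ] z
  ⊑-trans {x} {y} {z} = proj₂ (proj₁ good) x y z

  ⊏-trans : ∀ {x y z} → Valid m n x → Valid m n y → Valid m n z → x ⊏[ v ] y → y ⊏[ v ] z → x ⊏[ v ] z
  ⊏-trans {x} {y} {z} vx vy vz (x⊑y , _) (y⊑z , z⋢y) =
    ⊑-trans {x} {y} {z} vx vy vz x⊑y y⊑z , λ z⊑x → z⋢y (⊑-trans {z} {x} {y} vz vx vy z⊑x x⊑y)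

  ⊑∧≢⇒⊏ : ∀ {x y} → Valid m n x → Valid m n y → x ≢ y → x ⊑[ v ] y → x ⊏[ v ] y
  ⊑∧≢⇒⊏ {x} {y} vx vy x≢y x⊑y = x⊑y , λ y⊑x → x≢y (vertex x y vx vy (x⊑y , y⊑x))

  IsMaxOn : ℕ → ℕ → ℕ → Set
  IsMaxOn lo hi j = lo ≤ j × j ≤ hi × (∀ {i} → lo ≤ i → i ≤ hi → i ≢ j → M i ⊏[ v ] M j)

  interval-max : ∀ lo hi → 1 ≤ lo → lo ≤ hi → hi < m → ∃ (IsMaxOn lo hi)
  interval-max lo zero    1≤lo lo≤0 _ = contradiction (≤-trans 1≤lo lo≤0) λ ()
  interval-max lo (suc h) 1≤lo lo≤h+1 h+1<m with lo ≤? h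
  ... | no lo≰h = suc h , lo≤h+1 , ≤-refl ,
        λ lo≤i i≤h+1 → contradiction (≤-antisym i≤h+1 (≤-trans (≰⇒> lo≰h) lo≤i))
  ... | yes lo≤h with interval-max lo h 1≤lo lo≤h (<-trans (n<1+n h) h+1<m)
  ...   | j , lo≤j , j≤h , j-max = extend j⊏h+1⊎h+1⊏j
    where
    valid : ∀ {i} → lo ≤ i → i ≤ suc h → Valid m n (M i)
    valid lo≤i i≤h+1 = validM⁺ (≤-trans 1≤lo lo≤i) (≤-<-trans i≤h+1 h+1<m)
    vj = valid lo≤j (m≤n⇒m≤1+n j≤h)
    vh+1 = valid lo≤h+1 ≤-refl
    ≤h : ∀ {i} → i ≤ suc h → i ≢ suc h → i ≤ h
    ≤h i≤h+1 i≢h+1 = s≤s⁻¹ (≤∧≢⇒< i≤h+1 i≢h+1)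
    j≢h+1 : M j ≢ M (suc h)
    j≢h+1 refl = 1+n≰n j≤h
    -- No gap separates the running maximum m_j from m_{h+1}, so good rectangularity makes them comparable.
    no-gap : ¬ GapM m n v j (suc h)
    no-gap (t , _ , inj₂ (h+1≤t , t≤j) , _) = 1+n≰n (≤-trans h+1≤t (≤-trans t≤j j≤h))
    no-gap (t , _ , inj₁ (j≤t , t≤h+1) , j⊏t , h+1⊏t) with t ≟ suc h | t ≟ j
    ... | yes refl | _        = ⊏-irrefl {v} h+1⊏t
    ... | no _     | yes refl = ⊏-irrefl {v} j⊏t
    ... | no t≢h+1 | no t≢j   = ⊏-asym {v} j⊏t (j-max (≤-trans lo≤j j≤t) (≤h t≤h+1 t≢h+1) t≢j)
    j⊏h+1⊎h+1⊏j : M j ⊏[ v ] M (suc h) ⊎ M (suc h) ⊏[ v ] M j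
    j⊏h+1⊎h+1⊏j with proj₂ (proj₁ (proj₂ (proj₂ good)) j (suc h) vj vh+1) (inj₂ no-gap)
    ... | inj₁ j⊑h+1 = inj₁ (⊑∧≢⇒⊏ vj vh+1 j≢h+1 j⊑h+1)
    ... | inj₂ h+1⊑j = inj₂ (⊑∧≢⇒⊏ vh+1 vj (j≢h+1 ∘ sym) h+1⊑j)
    extend : M j ⊏[ v ] M (suc h) ⊎ M (suc h) ⊏[ v ] M j → ∃ (IsMaxOn lo (suc h))
    extend (inj₁ j⊏h+1) = suc h , lo≤h+1 , ≤-refl , new-max
      where
      new-max : ∀ {i} → lo ≤ i → i ≤ suc h → i ≢ suc h → M i ⊏[ v ] M (suc h)
      new-max {i} lo≤i i≤h+1 i≢h+1 with i ≟ j
      ... | yes refl = j⊏h+1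
      ... | no i≢j   = ⊏-trans {M i} {M j} {M (suc h)} (valid lo≤i i≤h+1) vj vh+1
                         (j-max lo≤i (≤h i≤h+1 i≢h+1) i≢j) j⊏h+1
    extend (inj₂ h+1⊏j) = j , lo≤j , m≤n⇒m≤1+n j≤h , old-max
      where
      old-max : ∀ {i} → lo ≤ i → i ≤ suc h → i ≢ j → M i ⊏[ v ] M j
      old-max {i} lo≤i i≤h+1 i≢j with i ≟ suc h
      ... | yes refl = h+1⊏j
      ... | no i≢h+1 = j-max lo≤i (≤h i≤h+1 i≢h+1) i≢j

  sum-truncCoord-split : ∀ s L₁ L₂ → 1 ≤ s → s + suc (L₁ + L₂) ≤ m →
    IsMaxOn s (s + (L₁ + L₂)) (s + L₁) →
    let j = s + L₁ ; g = truncCoord m v s (s + suc (L₁ + L₂)) in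
    sumFrom g s (suc (L₁ + L₂)) ≡
      sumFrom (truncCoord m v s j) s L₁ +
      (suc L₁ * suc L₂ + sumFrom (truncCoord m v (suc j) (suc j + L₂)) (suc j) L₂)
  sum-truncCoord-split s L₁ L₂ 1≤s e≤m (_ , _ , j-max) = begin
    sumFrom g s (suc (L₁ + L₂))             ≡⟨ cong (sumFrom g s) (sym (+-suc L₁ L₂)) ⟩
    sumFrom g s (L₁ + suc L₂)               ≡⟨ sumFrom-++ g s L₁ (suc L₂) ⟩
    sumFrom g s L₁ + (g j + sumFrom g (suc j) L₂)
      ≡⟨ cong₂ _+_ (sumFrom-cong s L₁ left) (cong₂ _+_ peak (sumFrom-cong (suc j) L₂ right)) ⟩
    sumFrom (truncCoord m v s j) s L₁ +
      (suc L₁ * suc L₂ + sumFrom (truncCoord m v (suc j) (suc j + L₂)) (suc j) L₂) ∎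
    where
    open ≡-Reasoning
    j = s + L₁
    e = s + suc (L₁ + L₂)
    g = truncCoord m v s e
    e≡j+1+L₂ : e ≡ j + suc L₂
    e≡j+1+L₂ = trans (cong (s +_) (sym (+-suc L₁ L₂))) (sym (+-assoc s L₁ (suc L₂)))
    j<e : j < e
    j<e = subst (j <_) (sym e≡j+1+L₂) (m<m+n j z<s)
    in-range : ∀ {i} → i < e → i ≤ s + (L₁ + L₂)
    in-range {i} i<e = s≤s⁻¹ (subst (i <_) (+-suc s (L₁ + L₂)) i<e)
    index-valid : ∀ {i} → s ≤ i → i < e → 1 ≤ i × i < m
    index-valid s≤i i<e = ≤-trans 1≤s s≤i , <-≤-trans i<e e≤m
    left : ∀ {i} → s ≤ i → i < s + L₁ → g i ≡ truncCoord m v s j i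
    left s≤i i<j = truncCoord-end {s = s} (≤-trans q≤j (<⇒≤ j<e)) q≤j
      where
      q≤j = qIdx-blocked (proj₂ (index-valid s≤i (<-trans i<j j<e))) i<j
              (j-max s≤i (in-range (<-trans i<j j<e)) (<⇒≢ i<j))
    peak : g j ≡ suc L₁ * suc L₂
    peak = begin
      g j                   ≡⟨ truncCoord-peak p≤s e≤q ⟩
      (j ∸ s + 1) * (e ∸ j) ≡⟨ cong₂ _*_ (trans (cong (_+ 1) (m+n∸m≡n s L₁)) (+-comm L₁ 1))
                                         (trans (cong (_∸ j) e≡j+1+L₂) (m+n∸m≡n j (suc L₂))) ⟩
      suc L₁ * suc L₂       ∎
      where
      p≤s = pIdx-least 1≤s (m≤m+n s L₁)
              (λ s≤k k<j → j-max s≤k (in-range (<-trans k<j j<e)) (<⇒≢ k<j))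
      e≤q = qIdx-greatest (proj₂ (index-valid (m≤m+n s L₁) j<e)) j<e e≤m
              (λ j<k k<e → j-max (≤-trans (m≤m+n s L₁) (<⇒≤ j<k)) (in-range k<e) (>⇒≢ j<k))
    right : ∀ {i} → suc j ≤ i → i < suc j + L₂ → g i ≡ truncCoord m v (suc j) (suc j + L₂) i
    right {i} j<i i<e′ = trans (truncCoord-start {e = e} (≤-trans (m≤m+n s L₁) (<⇒≤ j<p)) j<p)
                               (cong (λ e′ → truncCoord m v (suc j) e′ i) (trans e≡j+1+L₂ (+-suc j L₂)))
      where
      s≤i = ≤-trans (m≤m+n s L₁) (<⇒≤ j<i)
      i<e = subst (i <_) (sym (trans e≡j+1+L₂ (+-suc j L₂))) i<e′
      j<p = pIdx-blocked (proj₁ (index-valid s≤i i<e)) j<i (j-max s≤i (in-range i<e) (>⇒≢ j<i))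

  sum-truncCoord : ∀ k s → 1 ≤ s → s + k ≤ m → sumFrom (truncCoord m v s (s + k)) s k ≡ triangle k
  sum-truncCoord = <-rec _ step
    where
    step : ∀ k → (∀ {k′} → k′ < k → ∀ s → 1 ≤ s → s + k′ ≤ m →
                    sumFrom (truncCoord m v s (s + k′)) s k′ ≡ triangle k′) →
           ∀ s → 1 ≤ s → s + k ≤ m → sumFrom (truncCoord m v s (s + k)) s k ≡ triangle k
    step zero    _   _ _   _   = refl
    step (suc K) rec s 1≤s e≤m
      with interval-max s (s + K) 1≤s (m≤m+n s K) (subst (_≤ m) (+-suc s K) e≤m)
    ... | j , s≤j , j≤s+K , j-max with m≤n⇒∃[o]m+o≡n s≤j
    ... | L₁ , refl with m≤n⇒∃[o]m+o≡n (+-cancelˡ-≤ s L₁ K j≤s+K)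
    ... | L₂ , refl = begin
      sumFrom (truncCoord m v s (s + suc (L₁ + L₂))) s (suc (L₁ + L₂))
        ≡⟨ sum-truncCoord-split s L₁ L₂ 1≤s e≤m (s≤j , j≤s+K , j-max) ⟩
      sumFrom (truncCoord m v s j) s L₁ +
        (suc L₁ * suc L₂ + sumFrom (truncCoord m v (suc j) (suc j + L₂)) (suc j) L₂)
        ≡⟨ cong₂ _+_ (rec (s≤s (m≤m+n L₁ L₂)) s 1≤s j≤m)
                     (cong (suc L₁ * suc L₂ +_) (rec (s≤s (m≤n+m L₂ L₁)) (suc j) (s≤s z≤n) j+1+L₂≤m)) ⟩
      triangle L₁ + (suc L₁ * suc L₂ + triangle L₂)  ≡⟨ sym (triangle-+ L₁ L₂) ⟩
      triangle (L₁ + suc L₂)                         ≡⟨ cong triangle (+-suc L₁ L₂) ⟩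
      triangle (suc (L₁ + L₂))                       ∎
      where
      open ≡-Reasoning
      e≡j+1+L₂ : s + suc (L₁ + L₂) ≡ suc j + L₂
      e≡j+1+L₂ = trans (+-suc s (L₁ + L₂)) (cong suc (sym (+-assoc s L₁ L₂)))
      j≤m : j ≤ m
      j≤m = ≤-trans (+-monoʳ-≤ s (≤-trans (m≤m+n L₁ L₂) (n≤1+n _))) e≤m
      j+1+L₂≤m : suc j + L₂ ≤ m
      j+1+L₂≤m = subst (_≤ m) e≡j+1+L₂ e≤m

  L⋢M : ∀ {s j} → Tc n v j ≡ 1 → Valid m n (L s) → Valid m n (M j) → ¬ L s ⊑[ v ] M j
  L⋢M Tc≡1 vs@(1≤s , s≤n∸1) vj s⊑j =
    <-irrefl (sym Tc≡1) (1<Tc 1≤s (≤∸1⇒< 1≤s s≤n∸1) (⊑∧≢⇒⊏ vs vj (λ ()) s⊑j))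

  -- The orthogonal link that good rectangularity would demand lies below m_j.
  ¬GapM-below : ∀ {k j} → Tc n v j ≡ 1 → Valid m n (M k) → Valid m n (M j) →
                M k ⊏[ v ] M j → ¬ GapM m n v k j
  ¬GapM-below {k} {j} Tc≡1 vk vj (k⊑j , j⋢k) gap
    with proj₁ (proj₁ (proj₂ (proj₂ good)) k j vk vj) (inj₁ k⊑j)
  ... | inj₁ (s , vs , inj₁ (_ , s⊑j))   = L⋢M Tc≡1 vs vj s⊑j
  ... | inj₁ (s , vs , inj₂ (j⊑s , s⊑k)) = j⋢k (⊑-trans {M j} {L s} {M k} vj vs vk j⊑s s⊑k)
  ... | inj₂ no-gap                      = no-gap gap

module TwoClassPreorder {m n : ℕ} {F : PRel} {a c : ℕ} (1≤a : 1 ≤ a) (a≤c : a ≤ c) (c<m : c < m)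
  (two : TwoClasses m n F a c) {v : PRel} (good : GoodRect m n v) (vertex : IsVertex m n v) where

  open Coordinates m n v
  open Vertex good vertex

  private
    inside : ∀ {x y} → Valid m n x → Valid m n y → InJ a c x → InJ a c y → x ⊑[ F ] y
    inside {x} {y} = proj₁ two x y

    outside : ∀ {x y} → Valid m n x → Valid m n y → ¬ InJ a c x → ¬ InJ a c y → x ⊑[ F ] y
    outside {x} {y} = proj₁ (proj₂ two) x y

    J<outside : ∀ {x y} → Valid m n x → Valid m n y → InJ a c x → ¬ InJ a c y → x ⊏[ F ] y
    J<outside {x} {y} = proj₁ (proj₂ (proj₂ two)) x y

    validJ : ∀ {j} → a ≤ j → j ≤ c → Valid m n (M j)
    validJ a≤j j≤c = validM⁺ (≤-trans 1≤a a≤j) (≤-<-trans j≤c c<m)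

    L∉J : ∀ {s} → ¬ InJ a c (L s)
    L∉J (_ , () , _)

    left∉J : ∀ {k} → k < a → ¬ InJ a c (M k)
    left∉J k<a (_ , refl , a≤k , _) = <⇒≱ k<a a≤k

    right∉J : ∀ {k} → c < k → ¬ InJ a c (M k)
    right∉J c<k (_ , refl , _ , k≤c) = <⇒≱ c<k k≤c

  InJ? : ∀ x → Dec (InJ a c x)
  InJ? (L s) = no L∉J
  InJ? (M j) with a ≤? j | j ≤? c
  ... | yes a≤j | yes j≤c = yes (j , refl , a≤j , j≤c)
  ... | no a≰j  | _       = no (left∉J (≰⇒> a≰j))
  ... | yes _   | no j≰c  = no (right∉J (≰⇒> j≰c))

  confined-of-≤C : v ≤C[ m , n ] F → ∀ {j} → a ≤ j → j ≤ c → Confined m n v a (suc c) j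
  confined-of-≤C v≤F {j} a≤j j≤c =
    a≤p , q≤c+1 , Tc≡1 (λ 1≤s s<n → outside⋢ (1≤s , <⇒≤∸1 s<n) L∉J ∘ proj₁)
    where
    vj = validJ a≤j j≤c
    j<m = validM⁻ vj
    outside⋢ : ∀ {y} → Valid m n y → ¬ InJ a c y → ¬ y ⊑[ v ] M j
    outside⋢ {y} vy y∉J y⊑j = proj₂ (J<outside vj vy (j , refl , a≤j , j≤c) y∉J) (v≤F y (M j) vy vj y⊑j)
    a≤p : a ≤ pIdx v j
    a≤p = ≮⇒≥ λ p<a → outside⋢ (validM⁺ (proj₁ (pIdx-bounds (proj₁ vj))) (<-trans (<-≤-trans p<a a≤j) j<m))
            (left∉J p<a) (proj₁ (pIdx-below (proj₁ vj) ≤-refl (<-≤-trans p<a a≤j)))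
    q≤c+1 : qIdx m v j ≤ suc c
    q≤c+1 = ≮⇒≥ λ c+1<q → outside⋢ (validM⁺ (s≤s z≤n) (<-≤-trans c+1<q (proj₂ (qIdx-bounds j<m))))
              (right∉J ≤-refl) (proj₁ (qIdx-below j<m (s≤s j≤c) c+1<q))

  module _ (confined : ∀ {j} → a ≤ j → j ≤ c → Confined m n v a (suc c) j) where

    -- For t the maximum of m_k, …, m_j: if t ∈ J the window of m_t reaches k, otherwise m_t is a gap.
    left⋢J : ∀ {k j} → 1 ≤ k → k < a → a ≤ j → j ≤ c → ¬ M k ⊏[ v ] M j
    left⋢J {k} {j} 1≤k k<a a≤j j≤c k⊏j with interval-max k j 1≤k k≤j (validM⁻ vj)
      where
      vj = validJ a≤j j≤c
      k≤j = <⇒≤ (<-≤-trans k<a a≤j)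
    ... | t , k≤t , t≤j , t-max with a ≤? t
    ...   | yes a≤t = <⇒≱ k<a (≤-trans (proj₁ (confined a≤t (≤-trans t≤j j≤c))) p≤k)
      where
      p≤k = pIdx-least 1≤k k≤t (λ k≤i i<t → t-max k≤i (≤-trans (<⇒≤ i<t) t≤j) (<⇒≢ i<t))
    ...   | no a≰t = ¬GapM-below (proj₂ (proj₂ (confined a≤j j≤c))) vk vj k⊏j
                       (t , validM⁺ (≤-trans 1≤k k≤t) (≤-<-trans t≤j (validM⁻ vj)) ,
                        inj₁ (k≤t , t≤j) , k⊏t , j⊏t)
      where
      vj = validJ a≤j j≤c
      vk = validM⁺ 1≤k (<-trans k<a (≤-<-trans (≤-trans a≤j j≤c) c<m))
      k≤j = <⇒≤ (<-≤-trans k<a a≤j)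
      j⊏t = t-max k≤j ≤-refl (λ { refl → a≰t a≤j })
      k⊏t = t-max ≤-refl k≤j (λ { refl → ⊏-asym {v} k⊏j j⊏t })

    right⋢J : ∀ {k j} → c < k → k < m → a ≤ j → j ≤ c → ¬ M k ⊏[ v ] M j
    right⋢J {k} {j} c<k k<m a≤j j≤c k⊏j with interval-max j k (≤-trans 1≤a a≤j) j≤k k<m
      where
      j≤k = <⇒≤ (≤-<-trans j≤c c<k)
    ... | t , j≤t , t≤k , t-max with t ≤? c
    ...   | yes t≤c =
      <⇒≱ c<k (s≤s⁻¹ (≤-trans k+1≤q (proj₁ (proj₂ (confined (≤-trans a≤j j≤t) t≤c)))))
      where
      k+1≤q = qIdx-greatest (≤-<-trans t≤c c<m) (s≤s t≤k) k<m
                (λ t<i i≤k → t-max (≤-trans j≤t (<⇒≤ t<i)) (s≤s⁻¹ i≤k) (>⇒≢ t<i))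
    ...   | no t≰c = ¬GapM-below (proj₂ (proj₂ (confined a≤j j≤c))) vk vj k⊏j
                       (t , validM⁺ (≤-trans (≤-trans 1≤a a≤j) j≤t) (≤-<-trans t≤k k<m) ,
                        inj₂ (j≤t , t≤k) , k⊏t , j⊏t)
      where
      vj = validJ a≤j j≤c
      vk = validM⁺ (≤-trans (≤-trans 1≤a a≤j) (<⇒≤ (≤-<-trans j≤c c<k))) k<m
      j≤k = <⇒≤ (≤-<-trans j≤c c<k)
      j⊏t = t-max ≤-refl j≤k (λ { refl → t≰c j≤c })
      k⊏t = t-max j≤k ≤-refl (λ { refl → ⊏-asym {v} k⊏j j⊏t })

    M⋢J : ∀ {k j} → Valid m n (M k) → ¬ InJ a c (M k) → a ≤ j → j ≤ c → ¬ M k ⊏[ v ] M j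
    M⋢J {k} vk k∉J a≤j j≤c with k <? a | c <? k
    ... | yes k<a | _       = left⋢J (proj₁ vk) k<a a≤j j≤c
    ... | no _    | yes c<k = right⋢J c<k (validM⁻ vk) a≤j j≤c
    ... | no k≮a  | no c≮k  = contradiction (k , refl , ≮⇒≥ k≮a , ≮⇒≥ c≮k) k∉J

    outside⋢J : ∀ {x j} → Valid m n x → ¬ InJ a c x → a ≤ j → j ≤ c → ¬ x ⊑[ v ] M j
    outside⋢J {L s} vs _   a≤j j≤c = L⋢M (proj₂ (proj₂ (confined a≤j j≤c))) vs (validJ a≤j j≤c)
    outside⋢J {M k} vk k∉J a≤j j≤c =
      M⋢J vk k∉J a≤j j≤c ∘ ⊑∧≢⇒⊏ vk (validJ a≤j j≤c) λ { refl → k∉J (k , refl , a≤j , j≤c) }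

    ≤C-of-confined : v ≤C[ m , n ] F
    ≤C-of-confined x y vx vy x⊑y with InJ? x | InJ? y
    ... | yes x∈J | yes y∈J = inside vx vy x∈J y∈J
    ... | no x∉J  | no y∉J  = outside vx vy x∉J y∉J
    ... | yes x∈J | no y∉J  = proj₁ (J<outside vx vy x∈J y∉J)
    ... | no x∉J  | yes (j , refl , a≤j , j≤c) = contradiction x⊑y (outside⋢J vx x∉J a≤j j≤c)

  confined? : ∀ j → Dec (Confined m n v a (suc c) j)
  confined? j = (a ≤? pIdx v j) ×-dec (qIdx m v j ≤? suc c) ×-dec (Tc n v j ≟ 1)

  private
    len = suc c ∸ a

    a+len≡1+c : a + len ≡ suc c
    a+len≡1+c = m+[n∸m]≡n (m≤n⇒m≤1+n a≤c)

    <a+len⇒≤c : ∀ {i} → i < a + len → i ≤ c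
    <a+len⇒≤c {i} i< = s≤s⁻¹ (subst (i <_) a+len≡1+c i<)

  sum-truncCoord-J : sumFromTo a c (truncCoord m v a (suc c)) ≡ (c ∸ a + 2) C 2
  sum-truncCoord-J = begin
    sumFromTo a c (truncCoord m v a (suc c))   ≡⟨ sum-range _ a (suc c) ⟩
    sumFrom (truncCoord m v a (suc c)) a len   ≡⟨ cong (λ e → sumFrom (truncCoord m v a e) a len) (sym a+len≡1+c) ⟩
    sumFrom (truncCoord m v a (a + len)) a len ≡⟨ sum-truncCoord len a 1≤a (subst (_≤ m) (sym a+len≡1+c) c<m) ⟩
    triangle len                               ≡⟨ sym (suc[k]C2≡triangle len) ⟩
    suc len C 2
      ≡⟨ cong (λ l → suc l C 2) (trans (+-∸-assoc 1 a≤c) (+-comm 1 (c ∸ a))) ⟩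
    suc (c ∸ a + 1) C 2                        ≡⟨ cong (_C 2) (sym (+-suc (c ∸ a) 1)) ⟩
    (c ∸ a + 2) C 2                            ∎
    where open ≡-Reasoning

  sum-coord-J≡ : v ≤C[ m , n ] F → sumFromTo a c (coord m n v) ≡ (c ∸ a + 2) C 2
  sum-coord-J≡ v≤F = begin
    sumFromTo a c (coord m n v)              ≡⟨ sum-range _ a (suc c) ⟩
    sumFrom (coord m n v) a len              ≡⟨ sumFrom-cong a len confined-eq ⟩
    sumFrom (truncCoord m v a (suc c)) a len ≡⟨ sym (sum-range _ a (suc c)) ⟩
    sumFromTo a c (truncCoord m v a (suc c)) ≡⟨ sum-truncCoord-J ⟩
    (c ∸ a + 2) C 2                          ∎
    where
    open ≡-Reasoning
    confined-eq : ∀ {i} → a ≤ i → i < a + len → coord m n v i ≡ truncCoord m v a (suc c) i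
    confined-eq a≤i i< = sym (truncCoord≡coord (confined-of-≤C v≤F a≤i (<a+len⇒≤c i<)))

  sum-coord-J> : ¬ v ≤C[ m , n ] F → (c ∸ a + 2) C 2 < sumFromTo a c (coord m n v)
  sum-coord-J> v≰F with all? confined? (range a (suc c))
  ... | yes all-confined =
    contradiction (≤C-of-confined λ a≤j j≤c → All.lookup all-confined (∈-range⁺ a≤j (s≤s j≤c))) v≰F
  ... | no not-all with find (¬All⇒Any¬ confined? _ not-all)
  ...   | j , j∈ , unconfined = begin-strict
    (c ∸ a + 2) C 2                          ≡⟨ sym sum-truncCoord-J ⟩
    sumFromTo a c (truncCoord m v a (suc c)) ≡⟨ sum-range _ a (suc c) ⟩
    sumFrom (truncCoord m v a (suc c)) a len
      <⟨ sumFrom-mono-< a len (λ {i} _ _ → truncCoord≤coord {a} {suc c} {i}) a≤j j<a+len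
           (truncCoord<coord (≤-<-trans j≤c c<m) a≤j (s≤s j≤c) unconfined) ⟩
    sumFrom (coord m n v) a len              ≡⟨ sym (sum-range _ a (suc c)) ⟩
    sumFromTo a c (coord m n v)              ∎
    where
    open ≤-Reasoning
    a≤j = proj₁ (∈-range⁻ a (suc c) j∈)
    j≤c = s≤s⁻¹ (proj₂ (∈-range⁻ a (suc c) j∈))
    j<a+len = subst (j <_) (sym a+len≡1+c) (s≤s j≤c)

mainTheorem15 : (m n : ℕ) (F : PRel) (a c : ℕ) →
    1 ≤ a → a ≤ c → c ≤ m ∸ 1 →
    GoodRect m n F → TwoClasses m n F a c →
    ((v : PRel) → GoodRect m n v → IsVertex m n v → v ≤C[ m , n ] F →
      sumFromTo a c (coord m n v) ≡ (c ∸ a + 2) C 2) ×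
    ((v : PRel) → GoodRect m n v → IsVertex m n v →
      ¬ (v ≤C[ m , n ] F) → ¬ (F ≤C[ m , n ] v) →
      (c ∸ a + 2) C 2 < sumFromTo a c (coord m n v))
mainTheorem15 m n F a c 1≤a a≤c c≤m∸1 _ two =
  (λ v good vertex v≤F → TwoClassPreorder.sum-coord-J≡ 1≤a a≤c c<m two good vertex v≤F) ,
  (λ v good vertex v≰F _ → TwoClassPreorder.sum-coord-J> 1≤a a≤c c<m two good vertex v≰F)
  where
  c<m : c < m
  c<m = ≤∸1⇒< (≤-trans 1≤a a≤c) c≤m∸1
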